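{- For every integer $N \geq 2$, the modular Conway amusical graph with modulus $N$ is strongly connected.
   Context: Conway's amusical function $U : \mathbb{N} \to \mathbb{N}$ is $U(n) = 3n/2$ if $n$ is even, $U(n) = (3n+1)/4$ if $n \equiv 1 \pmod 4$, and $U(n) = (3n-1)/4$ if $n \equiv -1 \pmod 4$. For $N \in \mathbb{N}$ the modular Conway amusical graph is the directed graph on vertex set $\mathbb{Z}_N = \{0,\ldots,N-1\}$ with an edge $a \to b$ if and only if there exists $n \in \mathbb{N}$ with $n \equiv a \pmod N$ and $U(n) \equiv b \pmod N$. -}

module Defs where

open import Data.Nat using (ℕ; zero; suc; _+_; _*_; _∸_; NonZero)
open import Data.Nat.DivMod using (_/_; _%_; _mod_)
open import Data.Fin using (Fin)
open import Data.Product using (∃-syntax; _×_)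
open import Relation.Binary.PropositionalEquality using (_≡_)
open import Relation.Binary.Construct.Closure.ReflexiveTransitive using (Star)

U-aux : ℕ → ℕ → ℕ
U-aux 0 n = (3 * n) / 2
U-aux 1 n = (3 * n + 1) / 4
U-aux 2 n = (3 * n) / 2
U-aux _ n = (3 * n ∸ 1) / 4

U : ℕ → ℕ
U n = U-aux (n % 4) n

Edge : (N : ℕ) → .{{_ : NonZero N}} → Fin N → Fin N → Set
Edge N a b = ∃[ n ] ((n mod N ≡ a) × (U n mod N ≡ b))

StronglyConnected : (N : ℕ) → .{{_ : NonZero N}} → Set
StronglyConnected N = (a b : Fin N) → Star (Edge N) a b

-- Write N = 2 ^ α * 3 ^ β * M with M coprime to 6. As long as an orbit of U stays in the same
-- branches it is affine: the first j branches taken from y only depend on y modulo some 2 ^ E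
-- with E ≥ j, and U ^ j (y + 2 ^ E * m) = U ^ j y + 3 ^ j * m. Taking m a multiple of 3 ^ β * M,
-- resp. 2 ^ α * M, shows that x reaches every residue modulo 3 ^ β * M of U ^ α x, and that every
-- residue modulo 2 ^ α * M of a β-fold preimage of y reaches y. It remains to move freely modulo M.
-- On the classes 1 + 4 ^ J * m and 4 ^ J * k - 1, U ^ J multiplies the distance to the fixed
-- point 1, resp. -1, by (3/4) ^ J. Since 3 ^ K ≡ 4 ^ K (mod M) for some K ≥ 1, a step near 1 with
-- J ≡ 1 followed by a step near -1 with J ≡ -1 (mod K) translates residues modulo M by 2/3, and
-- iterating this reaches every residue modulo M. The Chinese remainder theorem glues the three
-- parts together.
module Submission where

open import Defs
open import Data.Nat using (ℕ; _≤_; NonZero)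

import Algebra.Properties.CommutativeSemigroup as CommSemigroupProperties
open import Data.Fin using (Fin; toℕ; zero; suc)
open import Data.Fin.Properties using (pigeonhole; toℕ-injective; toℕ-fromℕ<; toℕ<n)
open import Data.List using (_∷_; [])
open import Data.Nat
open import Data.Nat.Coprimality using (Coprime; coprime-Bézout)
open import Data.Nat.Divisibility
  using (_∣_; _∤_; _∣?_; divides; m∣m*n; n∣m*n; *-pres-∣; >⇒∤)
open import Data.Nat.DivMod
open import Data.Nat.GCD using (module Bézout)
open import Data.Nat.GeneralisedArithmetic using (iterate)
open import Data.Nat.Induction using (<-wellFounded)
open import Data.Nat.Primality
  using (Prime; prime?; prime[2]; prime⇒irreducible; prime⇒nonTrivial; euclidsLemma)
open import Data.Nat.Properties
open import Data.Nat.Tactic.RingSolver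
open import Data.Product
open import Data.Sum using (inj₁; inj₂)
open import Induction.WellFounded using (Acc; acc)
open import Level using (0ℓ)
open import Relation.Binary.Bundles using (Setoid)
open import Relation.Binary.Construct.Closure.ReflexiveTransitive using (Star; ε; _◅_; _◅◅_)
open import Relation.Binary.PropositionalEquality
import Relation.Binary.Reasoning.Setoid as SetoidReasoning
open import Relation.Nullary using (yes; no; contradiction)
open import Relation.Nullary.Decidable using (toWitness)

private module *-Comm = CommSemigroupProperties *-commutativeSemigroup

infix 4 _≡_[mod_]
record _≡_[mod_] (a b p : ℕ) : Set where
  constructor congruent
  field
    k l      : ℕ
    equation : a + k * p ≡ b + l * p

module _ {p : ℕ} where

  ≡⇒≡[mod] : ∀ {a b} → a ≡ b → a ≡ b [mod p ]
  ≡⇒≡[mod] refl = congruent 0 0 refl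

  ≡[mod]-refl : ∀ {a} → a ≡ a [mod p ]
  ≡[mod]-refl = ≡⇒≡[mod] refl

  ≡[mod]-sym : ∀ {a b} → a ≡ b [mod p ] → b ≡ a [mod p ]
  ≡[mod]-sym (congruent k l eq) = congruent l k (sym eq)

  ≡[mod]-trans : ∀ {a b c} → a ≡ b [mod p ] → b ≡ c [mod p ] → a ≡ c [mod p ]
  ≡[mod]-trans {a} {b} {c} (congruent k l eq₁) (congruent k′ l′ eq₂) =
    congruent (k + k′) (l′ + l) (begin
      a + (k + k′) * p       ≡⟨ solve (a ∷ k ∷ k′ ∷ p ∷ []) ⟩
      (a + k * p) + k′ * p   ≡⟨ cong (_+ k′ * p) eq₁ ⟩
      (b + l * p) + k′ * p   ≡⟨ solve (b ∷ l ∷ k′ ∷ p ∷ []) ⟩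
      (b + k′ * p) + l * p   ≡⟨ cong (_+ l * p) eq₂ ⟩
      (c + l′ * p) + l * p   ≡⟨ solve (c ∷ l′ ∷ l ∷ p ∷ []) ⟩
      c + (l′ + l) * p       ∎)
    where open ≡-Reasoning

≡[mod]-setoid : ℕ → Setoid 0ℓ 0ℓ
≡[mod]-setoid p = record
  { Carrier       = ℕ
  ; _≈_           = _≡_[mod p ]
  ; isEquivalence = record { refl = ≡[mod]-refl ; sym = ≡[mod]-sym ; trans = ≡[mod]-trans }
  }

module ≡[mod]-Reasoning (p : ℕ) = SetoidReasoning (≡[mod]-setoid p)

≡[mod]-+-∣ : ∀ {p} a {b} → p ∣ b → a + b ≡ a [mod p ]
≡[mod]-+-∣ a (divides q refl) = congruent 0 q (+-identityʳ _)

≡[mod]-+-cong : ∀ {p a b c d} → a ≡ b [mod p ] → c ≡ d [mod p ] → a + c ≡ b + d [mod p ]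
≡[mod]-+-cong {p} {a} {b} {c} {d} (congruent k l eq₁) (congruent k′ l′ eq₂) =
  congruent (k + k′) (l + l′) (begin
    (a + c) + (k + k′) * p       ≡⟨ solve (a ∷ c ∷ k ∷ k′ ∷ p ∷ []) ⟩
    (a + k * p) + (c + k′ * p)   ≡⟨ cong₂ _+_ eq₁ eq₂ ⟩
    (b + l * p) + (d + l′ * p)   ≡⟨ solve (b ∷ d ∷ l ∷ l′ ∷ p ∷ []) ⟩
    (b + d) + (l + l′) * p       ∎)
  where open ≡-Reasoning

≡[mod]-+-congˡ : ∀ {p a b} c → a ≡ b [mod p ] → c + a ≡ c + b [mod p ]
≡[mod]-+-congˡ c = ≡[mod]-+-cong (≡[mod]-refl {a = c})

≡[mod]-+-congʳ : ∀ {p a b} c → a ≡ b [mod p ] → a + c ≡ b + c [mod p ]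
≡[mod]-+-congʳ c a≡b = ≡[mod]-+-cong a≡b (≡[mod]-refl {a = c})

≡[mod]-*-congˡ : ∀ {p a b} c → a ≡ b [mod p ] → c * a ≡ c * b [mod p ]
≡[mod]-*-congˡ {p} {a} {b} c (congruent k l eq) = congruent (c * k) (c * l) (begin
  c * a + c * k * p   ≡⟨ solve (c ∷ a ∷ k ∷ p ∷ []) ⟩
  c * (a + k * p)     ≡⟨ cong (c *_) eq ⟩
  c * (b + l * p)     ≡⟨ solve (c ∷ b ∷ l ∷ p ∷ []) ⟩
  c * b + c * l * p   ∎)
  where open ≡-Reasoning

≡[mod]-*-congʳ : ∀ {p a b} c → a ≡ b [mod p ] → a * c ≡ b * c [mod p ]
≡[mod]-*-congʳ {p} {a} {b} c a≡b = begin
  a * c   ≡⟨ *-comm a c ⟩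
  c * a   ≈⟨ ≡[mod]-*-congˡ c a≡b ⟩
  c * b   ≡⟨ *-comm c b ⟩
  b * c   ∎
  where open ≡[mod]-Reasoning p

≡[mod]-*-cong : ∀ {p a b c d} → a ≡ b [mod p ] → c ≡ d [mod p ] → a * c ≡ b * d [mod p ]
≡[mod]-*-cong {b = b} {c = c} a≡b c≡d =
  ≡[mod]-trans (≡[mod]-*-congʳ c a≡b) (≡[mod]-*-congˡ b c≡d)

≡[mod]-^-cong : ∀ {p a b} → a ≡ b [mod p ] → ∀ n → a ^ n ≡ b ^ n [mod p ]
≡[mod]-^-cong a≡b zero    = ≡[mod]-refl
≡[mod]-^-cong a≡b (suc n) = ≡[mod]-*-cong a≡b (≡[mod]-^-cong a≡b n)

≡[mod]-+-cancelʳ : ∀ {p a b} c → a + c ≡ b + c [mod p ] → a ≡ b [mod p ]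
≡[mod]-+-cancelʳ {p} {a} {b} c (congruent k l eq) = congruent k l (+-cancelʳ-≡ c _ _ (begin
  a + k * p + c   ≡⟨ solve (a ∷ k ∷ p ∷ c ∷ []) ⟩
  a + c + k * p   ≡⟨ eq ⟩
  b + c + l * p   ≡⟨ solve (b ∷ c ∷ l ∷ p ∷ []) ⟩
  b + l * p + c   ∎))
  where open ≡-Reasoning

≡[mod]-*-scaleʳ : ∀ {q a b} p → a ≡ b [mod q ] → a * p ≡ b * p [mod q * p ]
≡[mod]-*-scaleʳ {q} {a} {b} p (congruent k l eq) = congruent k l (begin
  a * p + k * (q * p)   ≡⟨ solve (a ∷ p ∷ k ∷ q ∷ []) ⟩
  (a + k * q) * p       ≡⟨ cong (_* p) eq ⟩
  (b + l * q) * p       ≡⟨ solve (b ∷ p ∷ l ∷ q ∷ []) ⟩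
  b * p + l * (q * p)   ∎)
  where open ≡-Reasoning

≡[mod]-∣ : ∀ {a b p q} → p ∣ q → a ≡ b [mod q ] → a ≡ b [mod p ]
≡[mod]-∣ {a} {b} {p} (divides s refl) (congruent k l eq) = congruent (k * s) (l * s) (begin
  a + k * s * p     ≡⟨ cong (a +_) (*-assoc k s p) ⟩
  a + k * (s * p)   ≡⟨ eq ⟩
  b + l * (s * p)   ≡⟨ cong (b +_) (*-assoc l s p) ⟨
  b + l * s * p     ∎)
  where open ≡-Reasoning

module _ {n : ℕ} .{{_ : NonZero n}} where

  ≡[mod]⇒mod-≡ : ∀ {a b} → a ≡ b [mod n ] → a mod n ≡ b mod n
  ≡[mod]⇒mod-≡ {a} {b} (congruent k l eq) = toℕ-injective (begin
    toℕ (a mod n)     ≡⟨ toℕ-fromℕ< _ ⟩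
    a % n             ≡⟨ [m+kn]%n≡m%n a k n ⟨
    (a + k * n) % n   ≡⟨ cong (_% n) eq ⟩
    (b + l * n) % n   ≡⟨ [m+kn]%n≡m%n b l n ⟩
    b % n             ≡⟨ toℕ-fromℕ< _ ⟨
    toℕ (b mod n)     ∎)
    where open ≡-Reasoning

  mod-≡⇒≡[mod] : ∀ {a b} → a mod n ≡ b mod n → a ≡ b [mod n ]
  mod-≡⇒≡[mod] {a} {b} eq = begin
    a                 ≡⟨ m≡m%n+[m/n]*n a n ⟩
    a % n + a / n * n ≈⟨ ≡[mod]-+-∣ (a % n) (n∣m*n (a / n)) ⟩
    a % n             ≡⟨ toℕ-fromℕ< _ ⟨
    toℕ (a mod n)     ≡⟨ cong toℕ eq ⟩
    toℕ (b mod n)     ≡⟨ toℕ-fromℕ< _ ⟩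
    b % n             ≈⟨ ≡[mod]-+-∣ (b % n) (n∣m*n (b / n)) ⟨
    b % n + b / n * n ≡⟨ m≡m%n+[m/n]*n b n ⟨
    b                 ∎
    where open ≡[mod]-Reasoning n

  toℕ-mod : (a : Fin n) → toℕ a mod n ≡ a
  toℕ-mod a = toℕ-injective (trans (toℕ-fromℕ< (m%n<n (toℕ a) n)) (m<n⇒m%n≡m (toℕ<n a)))

record Invertible (c p : ℕ) : Set where
  constructor invertible
  field
    inverse  : ℕ
    inverseʳ : c * inverse ≡ 1 [mod p ]

module _ {p : ℕ} where

  inverse-* : ∀ {c d u v} → c * u ≡ 1 [mod p ] → d * v ≡ 1 [mod p ] →
              (c * d) * (u * v) ≡ 1 [mod p ]
  inverse-* {c} {d} {u} {v} cu≡1 dv≡1 = begin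
    (c * d) * (u * v)   ≡⟨ *-Comm.interchange c d u v ⟩
    (c * u) * (d * v)   ≈⟨ ≡[mod]-*-cong cu≡1 dv≡1 ⟩
    1                   ∎
    where open ≡[mod]-Reasoning p

  inverse-^ : ∀ {c u} → c * u ≡ 1 [mod p ] → ∀ n → c ^ n * u ^ n ≡ 1 [mod p ]
  inverse-^ cu≡1 zero    = ≡[mod]-refl
  inverse-^ {c} {u} cu≡1 (suc n) = inverse-* {c} {c ^ n} {u} {u ^ n} cu≡1 (inverse-^ cu≡1 n)

  invertible-* : ∀ {c d} → Invertible c p → Invertible d p → Invertible (c * d) p
  invertible-* {c} {d} (invertible u cu≡1) (invertible v dv≡1) =
    invertible (u * v) (inverse-* {c} {d} cu≡1 dv≡1)

  invertible-^ : ∀ {c} → Invertible c p → ∀ n → Invertible (c ^ n) p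
  invertible-^ (invertible u cu≡1) n = invertible (u ^ n) (inverse-^ cu≡1 n)

  invertible-cancelˡ : ∀ c {a b} → Invertible c p → c * a ≡ c * b [mod p ] → a ≡ b [mod p ]
  invertible-cancelˡ c {a} {b} (invertible u cu≡1) ca≡cb = begin
    a               ≈⟨ u[cx]≡x a ⟨
    u * (c * a)     ≈⟨ ≡[mod]-*-congˡ u ca≡cb ⟩
    u * (c * b)     ≈⟨ u[cx]≡x b ⟩
    b               ∎
    where
    open ≡[mod]-Reasoning p
    u[cx]≡x : ∀ x → u * (c * x) ≡ x [mod p ]
    u[cx]≡x x = begin
      u * (c * x)   ≡⟨ *-Comm.x∙yz≈yx∙z u c x ⟩
      (c * u) * x   ≈⟨ ≡[mod]-*-congʳ x cu≡1 ⟩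
      1 * x         ≡⟨ *-identityˡ x ⟩
      x             ∎

inverse-invertible : ∀ {c u p} → c * u ≡ 1 [mod p ] → Invertible u p
inverse-invertible {c} {u} {p} cu≡1 = invertible c (subst (_≡ 1 [mod p ]) (*-comm c u) cu≡1)

invertible-∣ : ∀ {c p q} → p ∣ q → Invertible c q → Invertible c p
invertible-∣ p∣q (invertible u cu≡1) = invertible u (≡[mod]-∣ p∣q cu≡1)

-- r = u (l + (p - 1) k), where (p - 1) k stands in for -k.
invertible-solve : ∀ {c p} → 0 < p → Invertible c p →
                   ∀ k l → ∃ λ r → k + c * r ≡ l [mod p ]
invertible-solve {c} {suc q} _ (invertible u cu≡1) k l = u * (l + q * k) , (begin
  k + c * (u * (l + q * k))   ≡⟨ solve (k ∷ c ∷ u ∷ l ∷ q ∷ []) ⟩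
  k + (c * u) * (l + q * k)   ≈⟨ ≡[mod]-+-congˡ k (≡[mod]-*-congʳ (l + q * k) cu≡1) ⟩
  k + 1 * (l + q * k)         ≡⟨ solve (k ∷ l ∷ q ∷ []) ⟩
  l + k * suc q               ≈⟨ ≡[mod]-+-∣ l (n∣m*n k) ⟩
  l                           ∎)
  where open ≡[mod]-Reasoning (suc q)

≡[mod]-lift : ∀ {z t p q c} → z ≡ t [mod p ] → 0 < q → Invertible c q →
              ∃ λ r → t + c * (p * r) ≡ z [mod q * p ]
≡[mod]-lift {z} {t} {p} {q} {c} (congruent k l z+kp≡t+lp) 0<q c⁻¹
  with r , k+cr≡l ← invertible-solve 0<q c⁻¹ k l =
  r , ≡[mod]-+-cancelʳ (l * p) (begin
    t + c * (p * r) + l * p   ≡⟨ solve (t ∷ c ∷ p ∷ r ∷ l ∷ []) ⟩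
    (t + l * p) + c * r * p   ≡⟨ cong (_+ c * r * p) z+kp≡t+lp ⟨
    (z + k * p) + c * r * p   ≡⟨ solve (z ∷ k ∷ p ∷ c ∷ r ∷ []) ⟩
    z + (k + c * r) * p       ≈⟨ ≡[mod]-+-congˡ z (≡[mod]-*-scaleʳ p k+cr≡l) ⟩
    z + l * p                 ∎)
  where open ≡[mod]-Reasoning (q * p)

^-distribʳ-* : ∀ a b n → (a * b) ^ n ≡ a ^ n * b ^ n
^-distribʳ-* a b zero    = refl
^-distribʳ-* a b (suc n) = begin
  a * b * (a * b) ^ n       ≡⟨ cong (a * b *_) (^-distribʳ-* a b n) ⟩
  a * b * (a ^ n * b ^ n)   ≡⟨ *-Comm.interchange a b (a ^ n) (b ^ n) ⟩
  a * a ^ n * (b * b ^ n)   ∎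
  where open ≡-Reasoning

^-monoʳ-∣ : ∀ a {m n} → m ≤ n → a ^ m ∣ a ^ n
^-monoʳ-∣ a {m} m≤n with o , refl ← m≤n⇒∃[o]m+o≡n m≤n =
  divides (a ^ o) (trans (^-distribˡ-+-* a m o) (*-comm (a ^ m) (a ^ o)))

unit-order : ∀ {g M} → 0 < M → Invertible g M → ∃ λ K → g ^ suc K ≡ 1 [mod M ]
unit-order {g} {M@(suc _)} _ g⁻¹
  with i , j , i<j , gⁱ≡gʲ ← pigeonhole (n<1+n M) (λ i → g ^ toℕ i mod M)
  with K , 1+i+K≡j ← m≤n⇒∃[o]m+o≡n i<j =
  K , ≡[mod]-sym (invertible-cancelˡ (g ^ toℕ i) (invertible-^ g⁻¹ (toℕ i)) (begin
    g ^ toℕ i * 1           ≡⟨ *-identityʳ _ ⟩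
    g ^ toℕ i               ≈⟨ mod-≡⇒≡[mod] {n = M} {a = g ^ toℕ i} {b = g ^ toℕ j} gⁱ≡gʲ ⟩
    g ^ toℕ j               ≡⟨ cong (g ^_) (trans (sym 1+i+K≡j) (sym (+-suc (toℕ i) K))) ⟩
    g ^ (toℕ i + suc K)     ≡⟨ ^-distribˡ-+-* g (toℕ i) (suc K) ⟩
    g ^ toℕ i * g ^ suc K   ∎))
  where open ≡[mod]-Reasoning M

order⇒powers-coincide : ∀ {c d u M} K → (c * u) ^ suc K ≡ 1 [mod M ] → d * u ≡ 1 [mod M ] →
                        c ^ suc K ≡ d ^ suc K [mod M ]
order⇒powers-coincide {c} {d} {u} {M} K [cu]ᴷ⁺¹≡1 du≡1 = begin
  cᴷ⁺¹                     ≡⟨ *-identityʳ cᴷ⁺¹ ⟨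
  cᴷ⁺¹ * 1                 ≈⟨ ≡[mod]-*-congˡ cᴷ⁺¹ (inverse-^ {c = d} {u = u} du≡1 (suc K)) ⟨
  cᴷ⁺¹ * (dᴷ⁺¹ * uᴷ⁺¹)     ≡⟨ *-Comm.x∙yz≈y∙xz cᴷ⁺¹ dᴷ⁺¹ uᴷ⁺¹ ⟩
  dᴷ⁺¹ * (cᴷ⁺¹ * uᴷ⁺¹)     ≡⟨ cong (dᴷ⁺¹ *_) (^-distribʳ-* c u (suc K)) ⟨
  dᴷ⁺¹ * (c * u) ^ suc K   ≈⟨ ≡[mod]-*-congˡ dᴷ⁺¹ [cu]ᴷ⁺¹≡1 ⟩
  dᴷ⁺¹ * 1                 ≡⟨ *-identityʳ dᴷ⁺¹ ⟩
  dᴷ⁺¹                     ∎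
  where
  open ≡[mod]-Reasoning M
  cᴷ⁺¹ dᴷ⁺¹ uᴷ⁺¹ : ℕ
  cᴷ⁺¹ = c ^ suc K
  dᴷ⁺¹ = d ^ suc K
  uᴷ⁺¹ = u ^ suc K

powers-coincide : ∀ {c d M} → 0 < M → Invertible c M → Invertible d M →
                  ∃ λ K → c ^ suc K ≡ d ^ suc K [mod M ]
powers-coincide {c} {d} 0<M c⁻¹ (invertible u du≡1) =
  let cu⁻¹ = invertible-* {c = c} {d = u} c⁻¹ (inverse-invertible {d} du≡1)
      K , [cu]ᴷ⁺¹≡1 = unit-order 0<M cu⁻¹
  in  K , order⇒powers-coincide {c} {d} {u} K [cu]ᴷ⁺¹≡1 du≡1

factor-out : ∀ {p} → 1 < p → ∀ n .{{_ : NonZero n}} → ∃₂ λ k m → n ≡ p ^ k * m × p ∤ m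
factor-out {p} 1<p n = go n (<-wellFounded n)
  where
  go : ∀ n → Acc _<_ n → .{{NonZero n}} → ∃₂ λ k m → n ≡ p ^ k * m × p ∤ m
  go n (acc rec) with p ∣? n
  ... | no p∤n = 0 , n , sym (*-identityˡ n) , p∤n
  ... | yes (divides q refl)
    with k , m , q≡pᵏm , p∤m ← go q (rec (m<m*n q p {{m*n≢0⇒m≢0 q}} 1<p)) {{m*n≢0⇒m≢0 q}} =
    suc k , m , (begin
      q * p             ≡⟨ cong (_* p) q≡pᵏm ⟩
      p ^ k * m * p     ≡⟨ *-Comm.xy∙z≈z∙xy (p ^ k) m p ⟩
      p * (p ^ k * m)   ≡⟨ *-assoc p (p ^ k) m ⟨
      p ^ suc k * m     ∎) , p∤m
    where open ≡-Reasoning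

prime∤⇒coprime : ∀ {p n} → Prime p → p ∤ n → Coprime p n
prime∤⇒coprime p-prime p∤n (d∣p , d∣n) with prime⇒irreducible p-prime d∣p
... | inj₁ d≡1  = d≡1
... | inj₂ refl = contradiction d∣n p∤n

prime∤⇒∤^ : ∀ {p m} → Prime p → p ∤ m → ∀ k → p ∤ m ^ k
prime∤⇒∤^ {p} p-prime p∤m zero = >⇒∤ (nonTrivial⇒n>1 p {{prime⇒nonTrivial p-prime}})
prime∤⇒∤^ {p} {m} p-prime p∤m (suc k) p∣mᵏ⁺¹
  with euclidsLemma m (m ^ k) p-prime p∣mᵏ⁺¹
... | inj₁ p∣m  = p∤m p∣m
... | inj₂ p∣mᵏ = prime∤⇒∤^ p-prime p∤m k p∣mᵏ

prime[3] : Prime 3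
prime[3] = toWitness {a? = prime? 3} _

coprime⇒invertible : ∀ {c p} → Coprime c p → Invertible c p
coprime⇒invertible {c} {p} c⊥p with coprime-Bézout c⊥p
... | Bézout.+- x y 1+yp≡xc = invertible x (congruent 0 y (begin
  c * x + 0   ≡⟨ +-identityʳ (c * x) ⟩
  c * x       ≡⟨ *-comm c x ⟩
  x * c       ≡⟨ 1+yp≡xc ⟨
  1 + y * p   ∎))
  where open ≡-Reasoning
... | Bézout.-+ x y 1+xc≡yp with p
...   | zero  = contradiction (trans 1+xc≡yp (*-zeroʳ y)) λ ()
...   | suc q = invertible (x * q) (congruent 1 (y * q) (begin
  c * (x * q) + 1 * suc q   ≡⟨ solve (c ∷ x ∷ q ∷ []) ⟩
  1 + (1 + x * c) * q       ≡⟨ cong (λ t → 1 + t * q) 1+xc≡yp ⟩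
  1 + y * suc q * q         ≡⟨ solve (y ∷ q ∷ []) ⟩
  1 + y * q * suc q         ∎))
  where open ≡-Reasoning

record Splitting (N : ℕ) : Set where
  field
    α β M   : ℕ
    N≡2ᵅ3ᵝM : N ≡ 2 ^ α * (3 ^ β * M)
    0<M     : 0 < M
    3⁻¹[A]  : Invertible 3 (2 ^ α)
    2⁻¹[BM] : Invertible 2 (3 ^ β * M)
    3⁻¹[M]  : Invertible 3 M

splitting : ∀ N .{{_ : NonZero N}} → Splitting N
splitting N {{N≢0}} =
  let α , R , N≡2ᵅR , 2∤R = factor-out {2} (n<1+n 1) N
      β , M , R≡3ᵝM , 3∤M = factor-out {3} (s≤s (s≤s z≤n)) R {{R≢0 α R N≡2ᵅR}}
      3∤2ᵅ = prime∤⇒∤^ prime[3] (>⇒∤ (n<1+n 2)) α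
  in record
    { α       = α
    ; β       = β
    ; M       = M
    ; N≡2ᵅ3ᵝM = trans N≡2ᵅR (cong (2 ^ α *_) R≡3ᵝM)
    ; 0<M     = >-nonZero⁻¹ M {{m*n≢0⇒n≢0 (3 ^ β) {{subst NonZero R≡3ᵝM (R≢0 α R N≡2ᵅR)}}}}
    ; 3⁻¹[A]  = coprime⇒invertible (prime∤⇒coprime prime[3] 3∤2ᵅ)
    ; 2⁻¹[BM] = subst (Invertible 2) R≡3ᵝM (coprime⇒invertible (prime∤⇒coprime prime[2] 2∤R))
    ; 3⁻¹[M]  = coprime⇒invertible (prime∤⇒coprime prime[3] 3∤M)
    }
  where
  R≢0 : ∀ α R → N ≡ 2 ^ α * R → NonZero R
  R≢0 α R N≡2ᵅR = m*n≢0⇒n≢0 (2 ^ α) {{subst NonZero N≡2ᵅR N≢0}}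

data Residue (d : ℕ) : ℕ → Set where
  residue : ∀ (r : Fin d) q → Residue d (toℕ r + d * q)

residue-view : ∀ d .{{_ : NonZero d}} n → Residue d n
residue-view d n with result q r n≡r+qd ← n divMod d =
  subst (Residue d) (trans (cong (toℕ r +_) (*-comm d q)) (sym n≡r+qd)) (residue r q)

m≡n*o⇒m/o≡n : ∀ m n o .{{_ : NonZero o}} → m ≡ n * o → m / o ≡ n
m≡n*o⇒m/o≡n _ n o refl = m*n/n≡m n o

U-by-residue : ∀ n s q → n ≡ s + 4 * q → s < 4 → U n ≡ U-aux s n
U-by-residue n s q refl s<4 = cong (λ r → U-aux r n) (begin
  (s + 4 * q) % 4   ≡⟨ cong (λ t → (s + t) % 4) (*-comm 4 q) ⟩
  (s + q * 4) % 4   ≡⟨ [m+kn]%n≡m%n s q 4 ⟩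
  s % 4             ≡⟨ m<n⇒m%n≡m s<4 ⟩
  s                 ∎)
  where open ≡-Reasoning

U-1mod4 : ∀ q → U (1 + 4 * q) ≡ 1 + 3 * q
U-1mod4 q = trans (U-by-residue _ 1 q refl (s<s z<s))
                  (m≡n*o⇒m/o≡n (3 * (1 + 4 * q) + 1) (1 + 3 * q) 4 (solve (q ∷ [])))

U-3mod4 : ∀ q → U (3 + 4 * q) ≡ 2 + 3 * q
U-3mod4 q = trans (U-by-residue _ 3 q refl (s<s (s<s (s<s z<s))))
                  (m≡n*o⇒m/o≡n (3 * (3 + 4 * q) ∸ 1) (2 + 3 * q) 4 (cong (_∸ 1) 3[3+4q]≡1+[2+3q]4))
  where
  3[3+4q]≡1+[2+3q]4 : 3 * (3 + 4 * q) ≡ 1 + (2 + 3 * q) * 4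
  3[3+4q]≡1+[2+3q]4 = solve (q ∷ [])

U-even : ∀ m → U (2 * m) ≡ 3 * m
U-even m with residue-view 2 m
... | residue zero q =
  trans (U-by-residue (2 * (2 * q)) 0 q (solve (q ∷ [])) z<s)
        (m≡n*o⇒m/o≡n (3 * (2 * (2 * q))) (3 * (2 * q)) 2 (solve (q ∷ [])))
... | residue (suc zero) q =
  trans (U-by-residue (2 * (1 + 2 * q)) 2 q (solve (q ∷ [])) (s<s (s<s z<s)))
        (m≡n*o⇒m/o≡n (3 * (2 * (1 + 2 * q))) (3 * (1 + 2 * q)) 2 (solve (q ∷ [])))

data Branch : ℕ → Set where
  even  : ∀ m → Branch (2 * m)
  1mod4 : ∀ q → Branch (1 + 4 * q)
  3mod4 : ∀ q → Branch (3 + 4 * q)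

branch : ∀ n → Branch n
branch n with residue-view 4 n
... | residue zero q                   = subst Branch (sym (*-assoc 2 2 q)) (even (2 * q))
... | residue (suc zero) q             = 1mod4 q
... | residue (suc (suc zero)) q       = subst Branch 2[1+2q]≡2+4q (even (1 + 2 * q))
  where
  2[1+2q]≡2+4q : 2 * (1 + 2 * q) ≡ 2 + 4 * q
  2[1+2q]≡2+4q = solve (q ∷ [])
... | residue (suc (suc (suc zero))) q = 3mod4 q

affine-shift : ∀ (f : ℕ → ℕ) a b c d → (∀ t → f (a + b * t) ≡ c + d * t) →
               ∀ m r → f (a + b * m + b * r) ≡ f (a + b * m) + d * r
affine-shift f a b c d f-affine m r = begin
  f (a + b * m + b * r)     ≡⟨ cong f (+-assoc a (b * m) (b * r)) ⟩
  f (a + (b * m + b * r))   ≡⟨ cong (λ t → f (a + t)) (*-distribˡ-+ b m r) ⟨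
  f (a + b * (m + r))       ≡⟨ f-affine (m + r) ⟩
  c + d * (m + r)           ≡⟨ solve (c ∷ d ∷ m ∷ r ∷ []) ⟩
  c + d * m + d * r         ≡⟨ cong (_+ d * r) (f-affine m) ⟨
  f (a + b * m) + d * r     ∎
  where open ≡-Reasoning

U-affine : ∀ y → ∃ λ e → 1 ≤ e × ∀ r → U (y + 2 ^ e * r) ≡ U y + 3 * r
U-affine y with branch y
... | even m  = 1 , ≤-refl  , affine-shift U 0 2 0 3 U-even m
... | 1mod4 q = 2 , s≤s z≤n , affine-shift U 1 4 1 3 U-1mod4 q
... | 3mod4 q = 2 , s≤s z≤n , affine-shift U 3 4 2 3 U-3mod4 q

iterate-U-affine : ∀ j y → ∃ λ E → j ≤ E × ∀ m →
                   iterate U (y + 2 ^ E * m) j ≡ iterate U y j + 3 ^ j * m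
iterate-U-affine zero    y = 0 , z≤n , λ m → refl
iterate-U-affine (suc j) y
  with e , 1≤e , U-step ← U-affine y
  with E , j≤E , Uʲ-affine ← iterate-U-affine j (U y) =
  e + E , +-mono-≤ 1≤e j≤E , λ m → begin
    iterate U (U (y + 2 ^ (e + E) * m)) j
      ≡⟨ cong (λ t → iterate U (U (y + t * m)) j) (^-distribˡ-+-* 2 e E) ⟩
    iterate U (U (y + 2 ^ e * 2 ^ E * m)) j
      ≡⟨ cong (λ t → iterate U (U (y + t)) j) (*-assoc (2 ^ e) (2 ^ E) m) ⟩
    iterate U (U (y + 2 ^ e * (2 ^ E * m))) j
      ≡⟨ cong (λ t → iterate U t j) (U-step (2 ^ E * m)) ⟩
    iterate U (U y + 3 * (2 ^ E * m)) j
      ≡⟨ cong (λ t → iterate U (U y + t) j) (*-Comm.x∙yz≈y∙xz 3 (2 ^ E) m) ⟩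
    iterate U (U y + 2 ^ E * (3 * m)) j
      ≡⟨ Uʲ-affine (3 * m) ⟩
    iterate U (U y) j + 3 ^ j * (3 * m)
      ≡⟨ cong (iterate U (U y) j +_) (*-Comm.x∙yz≈yx∙z (3 ^ j) 3 m) ⟩
    iterate U (U y) j + 3 * 3 ^ j * m
      ∎
  where open ≡-Reasoning

U-orbit-near-1 : ∀ J m → iterate U (1 + 4 ^ J * m) J ≡ 1 + 3 ^ J * m
U-orbit-near-1 zero    m = refl
U-orbit-near-1 (suc J) m = begin
  iterate U (U (1 + 4 * 4 ^ J * m)) J
    ≡⟨ cong (λ t → iterate U (U (1 + t)) J) (*-assoc 4 (4 ^ J) m) ⟩
  iterate U (U (1 + 4 * (4 ^ J * m))) J
    ≡⟨ cong (λ t → iterate U t J) (U-1mod4 (4 ^ J * m)) ⟩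
  iterate U (1 + 3 * (4 ^ J * m)) J
    ≡⟨ cong (λ t → iterate U (1 + t) J) (*-Comm.x∙yz≈y∙xz 3 (4 ^ J) m) ⟩
  iterate U (1 + 4 ^ J * (3 * m)) J
    ≡⟨ U-orbit-near-1 J (3 * m) ⟩
  1 + 3 ^ J * (3 * m)
    ≡⟨ cong (1 +_) (*-Comm.x∙yz≈yx∙z (3 ^ J) 3 m) ⟩
  1 + 3 * 3 ^ J * m
    ∎
  where open ≡-Reasoning

U-orbit-near-−1 : ∀ J k x → suc x ≡ 4 ^ J * k → suc (iterate U x J) ≡ 3 ^ J * k
U-orbit-near-−1 zero    k x 1+x≡k = 1+x≡k
U-orbit-near-−1 (suc J) k x 1+x≡4ᴶ⁺¹k with 4 ^ J * k in 4ᴶk≡n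
... | zero  = contradiction (trans 1+x≡4ᴶ⁺¹k (trans (*-assoc 4 (4 ^ J) k) (cong (4 *_) 4ᴶk≡n))) λ ()
... | suc q = begin
  suc (iterate U (U x) J)             ≡⟨ cong (λ t → suc (iterate U (U t) J)) x≡3+4q ⟩
  suc (iterate U (U (3 + 4 * q)) J)   ≡⟨ cong (λ t → suc (iterate U t J)) (U-3mod4 q) ⟩
  suc (iterate U (2 + 3 * q) J)       ≡⟨ U-orbit-near-−1 J (3 * k) (2 + 3 * q) 3+3q≡4ᴶ[3k] ⟩
  3 ^ J * (3 * k)                     ≡⟨ *-Comm.x∙yz≈yx∙z (3 ^ J) 3 k ⟩
  3 * 3 ^ J * k                       ∎
  where
  open ≡-Reasoning
  x≡3+4q : x ≡ 3 + 4 * q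
  x≡3+4q = suc-injective (begin
    suc x             ≡⟨ 1+x≡4ᴶ⁺¹k ⟩
    4 * 4 ^ J * k     ≡⟨ *-assoc 4 (4 ^ J) k ⟩
    4 * (4 ^ J * k)   ≡⟨ cong (4 *_) 4ᴶk≡n ⟩
    4 * suc q         ≡⟨ solve (q ∷ []) ⟩
    suc (3 + 4 * q)   ∎)
  3+3q≡4ᴶ[3k] : suc (2 + 3 * q) ≡ 4 ^ J * (3 * k)
  3+3q≡4ᴶ[3k] = begin
    suc (2 + 3 * q)   ≡⟨ solve (q ∷ []) ⟩
    3 * suc q         ≡⟨ cong (3 *_) 4ᴶk≡n ⟨
    3 * (4 ^ J * k)   ≡⟨ *-Comm.x∙yz≈y∙xz 3 (4 ^ J) k ⟩
    4 ^ J * (3 * k)   ∎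

U-surjective : ∀ z → ∃ λ n → U n ≡ z
U-surjective z with residue-view 3 z
... | residue zero t             = 2 * t , U-even t
... | residue (suc zero) t       = 1 + 4 * t , U-1mod4 t
... | residue (suc (suc zero)) t = 3 + 4 * t , U-3mod4 t

iterate-U-surjective : ∀ i z → ∃ λ n → iterate U n i ≡ z
iterate-U-surjective zero    z = z , refl
iterate-U-surjective (suc i) z
  with n , Uⁱn≡z ← iterate-U-surjective i z
  with m , Um≡n ← U-surjective n = m , trans (cong (λ t → iterate U t i) Um≡n) Uⁱn≡z

module Reachability (N : ℕ) .{{_ : NonZero N}} where

  infix 4 _⇝_ _⇝_[mod_]

  _⇝_ : ℕ → ℕ → Set
  x ⇝ y = Star (Edge N) (x mod N) (y mod N)

  _⇝_[mod_] : ℕ → ℕ → ℕ → Set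
  x ⇝ w [mod p ] = ∀ z → z ≡ w [mod p ] → x ⇝ z

  ⇝-respects : ∀ {x x′ y y′} → x ≡ x′ [mod N ] → y ≡ y′ [mod N ] → x ⇝ y → x′ ⇝ y′
  ⇝-respects x≡x′ y≡y′ = subst₂ (Star (Edge N)) (≡[mod]⇒mod-≡ x≡x′) (≡[mod]⇒mod-≡ y≡y′)

  ⇝-iterate : ∀ x j → x ⇝ iterate U x j
  ⇝-iterate x zero    = ε
  ⇝-iterate x (suc j) = (x , refl , refl) ◅ ⇝-iterate (U x) j

  ⇝-trajectory : ∀ x j → ∃ λ E → j ≤ E × ∀ m → x + 2 ^ E * m ⇝ iterate U x j + 3 ^ j * m
  ⇝-trajectory x j =
    let E , j≤E , Uʲ-affine = iterate-U-affine j x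
    in  E , j≤E , λ m → subst (x + 2 ^ E * m ⇝_) (Uʲ-affine m) (⇝-iterate (x + 2 ^ E * m) j)

module Connectivity {N : ℕ} .{{_ : NonZero N}} (S : Splitting N) where

  open Reachability N
  open Splitting S

  A B : ℕ
  A = 2 ^ α
  B = 3 ^ β

  0<B : 0 < B
  0<B = m^n>0 3 β

  0<BM : 0 < B * M
  0<BM = *-mono-< 0<B 0<M

  reduce-mod-M : ∀ {a b} → a ≡ b [mod B * M ] → a ≡ b [mod M ]
  reduce-mod-M = ≡[mod]-∣ (n∣m*n B)

  2⁻¹[B] : Invertible 2 B
  2⁻¹[B] = invertible-∣ (m∣m*n M) 2⁻¹[BM]

  2⁻¹[M] : Invertible 2 M
  2⁻¹[M] = invertible-∣ (n∣m*n B) 2⁻¹[BM]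

  4⁻¹[BM] : Invertible 4 (B * M)
  4⁻¹[BM] = invertible-* {c = 2} {d = 2} 2⁻¹[BM] 2⁻¹[BM]

  4⁻¹[M] : Invertible 4 M
  4⁻¹[M] = invertible-∣ (n∣m*n B) 4⁻¹[BM]

  ⇝-forward : ∀ x j → α ≤ j → x ⇝ iterate U x j [mod B * M ]
  ⇝-forward x j α≤j z z≡Uʲx =
    let E , j≤E , trajectory = ⇝-trajectory x j
        r , Uʲx+3ʲBMr≡z = ≡[mod]-lift z≡Uʲx (m^n>0 2 α) (invertible-^ 3⁻¹[A] j)
        A∣2ᴱ = ^-monoʳ-∣ 2 (≤-trans α≤j j≤E)
        N∣2ᴱBMr = subst (_∣ 2 ^ E * (B * M * r)) (sym N≡2ᵅ3ᵝM) (*-pres-∣ A∣2ᴱ (m∣m*n r))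
    in  ⇝-respects (≡[mod]-+-∣ x N∣2ᴱBMr)
                   (subst (iterate U x j + 3 ^ j * (B * M * r) ≡ z [mod_]) (sym N≡2ᵅ3ᵝM)
                          Uʲx+3ʲBMr≡z)
                   (trajectory (B * M * r))

  ⇝-backward : ∀ w i → β ≤ i → ∀ z → z ≡ w [mod A * M ] → z ⇝ iterate U w i
  ⇝-backward w i β≤i z z≡w =
    let E , i≤E , trajectory = ⇝-trajectory w i
        r , w+2ᴱAMr≡z = ≡[mod]-lift z≡w 0<B (invertible-^ 2⁻¹[B] E)
        N≡B[AM] = trans N≡2ᵅ3ᵝM (*-Comm.x∙yz≈y∙xz A B M)
        B∣3ⁱ = ^-monoʳ-∣ 3 β≤i
        N∣3ⁱAMr = subst (_∣ 3 ^ i * (A * M * r)) (sym N≡B[AM]) (*-pres-∣ B∣3ⁱ (m∣m*n r))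
    in  ⇝-respects (subst (w + 2 ^ E * (A * M * r) ≡ z [mod_]) (sym N≡B[AM]) w+2ᴱAMr≡z)
                   (≡[mod]-+-∣ (iterate U w i) N∣3ⁱAMr)
                   (trajectory (A * M * r))

  ⇝[mod]-spread : ∀ {x w w′} j → α ≤ j → x ⇝ w [mod B * M ] → w′ ≡ w [mod B * M ] →
                  x ⇝ iterate U w′ j [mod B * M ]
  ⇝[mod]-spread {w′ = w′} j α≤j x⇝w w′≡w z z≡Uʲw′ =
    x⇝w w′ w′≡w ◅◅ ⇝-forward w′ j α≤j z z≡Uʲw′

  step-near-1 : ∀ {x w} J → α ≤ J → x ⇝ w [mod B * M ] →
                ∃ λ m → 1 + 4 ^ J * m ≡ w [mod B * M ] × x ⇝ 1 + 3 ^ J * m [mod B * M ]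
  step-near-1 {x} {w} J α≤J x⇝w =
    let m , 1+4ᴶm≡w = invertible-solve 0<BM (invertible-^ 4⁻¹[BM] J) 1 w
    in  m , 1+4ᴶm≡w ,
        subst (λ v → x ⇝ v [mod B * M ]) (U-orbit-near-1 J m) (⇝[mod]-spread J α≤J x⇝w 1+4ᴶm≡w)

  step-near-−1 : ∀ {x w} J → α ≤ J → x ⇝ w [mod B * M ] →
                 ∃₂ λ k w′ → 4 ^ J * k ≡ suc w [mod B * M ] × (suc w′ ≡ 3 ^ J * k) ×
                             x ⇝ w′ [mod B * M ]
  step-near-−1 {x} {w} J α≤J x⇝w =
    let r , 4ᴶ+4ᴶr≡1+w = invertible-solve 0<BM (invertible-^ 4⁻¹[BM] J) (4 ^ J) (suc w)
        k = suc r
        v = pred (4 ^ J * k)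
        1+v≡4ᴶk = suc-pred (4 ^ J * k) {{m*n≢0 (4 ^ J) k {{m^n≢0 4 J}}}}
        4ᴶk≡1+w = subst (_≡ suc w [mod B * M ]) (sym (*-suc (4 ^ J) r)) 4ᴶ+4ᴶr≡1+w
        v≡w = ≡[mod]-+-cancelʳ 1
                (subst₂ (_≡_[mod B * M ]) (trans (sym 1+v≡4ᴶk) (+-comm 1 v)) (+-comm 1 w) 4ᴶk≡1+w)
    in  k , iterate U v J , 4ᴶk≡1+w , U-orbit-near-−1 J k v 1+v≡4ᴶk , ⇝[mod]-spread J α≤J x⇝w v≡w

  period : ∃ λ K₀ → 3 ^ suc K₀ ≡ 4 ^ suc K₀ [mod M ]
  period = powers-coincide 0<M 3⁻¹[M] 4⁻¹[M]

  K₀ K : ℕ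
  K₀ = proj₁ period
  K  = suc K₀

  3ᴷᵗ≡4ᴷᵗ : ∀ t → 3 ^ (K * t) ≡ 4 ^ (K * t) [mod M ]
  3ᴷᵗ≡4ᴷᵗ t = begin
    3 ^ (K * t)   ≡⟨ ^-*-assoc 3 K t ⟨
    (3 ^ K) ^ t   ≈⟨ ≡[mod]-^-cong (proj₂ period) t ⟩
    (4 ^ K) ^ t   ≡⟨ ^-*-assoc 4 K t ⟩
    4 ^ (K * t)   ∎
    where open ≡[mod]-Reasoning M

  J₁ J₂ : ℕ
  J₁ = suc (K * α)
  J₂ = K₀ + K * α

  α≤J₁ : α ≤ J₁
  α≤J₁ = ≤-trans (m≤n*m α K) (n≤1+n (K * α))

  α≤J₂ : α ≤ J₂
  α≤J₂ = ≤-trans (m≤n*m α K) (m≤n+m (K * α) K₀)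

  4·3ᴶ¹≡3·4ᴶ¹ : 4 * 3 ^ J₁ ≡ 3 * 4 ^ J₁ [mod M ]
  4·3ᴶ¹≡3·4ᴶ¹ = begin
    4 * (3 * 3 ^ (K * α))   ≡⟨ *-Comm.x∙yz≈y∙xz 4 3 (3 ^ (K * α)) ⟩
    3 * (4 * 3 ^ (K * α))   ≈⟨ ≡[mod]-*-congˡ 3 (≡[mod]-*-congˡ 4 (3ᴷᵗ≡4ᴷᵗ α)) ⟩
    3 * (4 * 4 ^ (K * α))   ∎
    where open ≡[mod]-Reasoning M

  3ᴶ²⁺¹≡4ᴶ²⁺¹ : 3 ^ suc J₂ ≡ 4 ^ suc J₂ [mod M ]
  3ᴶ²⁺¹≡4ᴶ²⁺¹ = subst (λ e → 3 ^ e ≡ 4 ^ e [mod M ]) (*-suc K α) (3ᴷᵗ≡4ᴷᵗ (suc α))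

  -- As J₁ ≡ 1 and J₂ ≡ -1 modulo K, modulo M the step near 1 multiplies w - 1 by 3/4 and the
  -- step near -1 multiplies w₁ + 1 by 4/3; together they translate w by 2/3.
  shift : ∀ {x w} → x ⇝ w [mod B * M ] →
          ∃ λ w′ → x ⇝ w′ [mod B * M ] × 3 * w′ ≡ 3 * w + 2 [mod M ]
  shift {x} {w} x⇝w =
    let m , 1+4ᴶ¹m≡w , x⇝w₁ = step-near-1 J₁ α≤J₁ x⇝w
        k , w₂ , 4ᴶ²k≡1+w₁ , 1+w₂≡3ᴶ²k , x⇝w₂ = step-near-−1 J₂ α≤J₂ x⇝w₁
    in  w₂ , x⇝w₂ , ≡[mod]-+-cancelʳ 3 (begin
      3 * w₂ + 3                 ≡⟨ trans (+-comm (3 * w₂) 3) (sym (*-suc 3 w₂)) ⟩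
      3 * suc w₂                 ≡⟨ cong (3 *_) 1+w₂≡3ᴶ²k ⟩
      3 * (3 ^ J₂ * k)           ≡⟨ *-assoc 3 (3 ^ J₂) k ⟨
      3 ^ suc J₂ * k             ≈⟨ ≡[mod]-*-congʳ k 3ᴶ²⁺¹≡4ᴶ²⁺¹ ⟩
      4 ^ suc J₂ * k             ≡⟨ *-assoc 4 (4 ^ J₂) k ⟩
      4 * (4 ^ J₂ * k)           ≈⟨ ≡[mod]-*-congˡ 4 (reduce-mod-M 4ᴶ²k≡1+w₁) ⟩
      4 * suc (1 + 3 ^ J₁ * m)   ≡⟨ expand (3 ^ J₁) m ⟩
      8 + 4 * 3 ^ J₁ * m         ≈⟨ ≡[mod]-+-congˡ 8 (≡[mod]-*-congʳ m 4·3ᴶ¹≡3·4ᴶ¹) ⟩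
      8 + 3 * 4 ^ J₁ * m         ≡⟨ regroup (4 ^ J₁) m ⟩
      3 * (1 + 4 ^ J₁ * m) + 5   ≈⟨ ≡[mod]-+-congʳ 5 (≡[mod]-*-congˡ 3 (reduce-mod-M 1+4ᴶ¹m≡w)) ⟩
      3 * w + 5                  ≡⟨ +-assoc (3 * w) 2 3 ⟨
      3 * w + 2 + 3              ∎)
    where
    open ≡[mod]-Reasoning M
    expand : ∀ X m → 4 * suc (1 + X * m) ≡ 8 + 4 * X * m
    expand = solve-∀
    regroup : ∀ Y m → 8 + 3 * Y * m ≡ 3 * (1 + Y * m) + 5
    regroup = solve-∀

  shifts : ∀ {x w} T → x ⇝ w [mod B * M ] →
           ∃ λ w′ → x ⇝ w′ [mod B * M ] × 3 * w′ ≡ 3 * w + 2 * T [mod M ]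
  shifts {w = w} zero    x⇝w = w , x⇝w , ≡⇒≡[mod] (sym (+-identityʳ (3 * w)))
  shifts {w = w} (suc T) x⇝w =
    let w′ , x⇝w′ , 3w′≡3w+2T = shifts T x⇝w
        w″ , x⇝w″ , 3w″≡3w′+2 = shift x⇝w′
    in  w″ , x⇝w″ , (begin
      3 * w″                ≈⟨ 3w″≡3w′+2 ⟩
      3 * w′ + 2            ≈⟨ ≡[mod]-+-congʳ 2 3w′≡3w+2T ⟩
      3 * w + 2 * T + 2     ≡⟨ +-assoc (3 * w) (2 * T) 2 ⟩
      3 * w + (2 * T + 2)   ≡⟨ cong (3 * w +_) (trans (+-comm (2 * T) 2) (sym (*-suc 2 T))) ⟩
      3 * w + 2 * suc T     ∎)
    where open ≡[mod]-Reasoning M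

  ⇝[mod]-every-class : ∀ x v → ∃ λ w → x ⇝ w [mod B * M ] × w ≡ v [mod M ]
  ⇝[mod]-every-class x v =
    let w₀ = iterate U x α
        T , 3w₀+2T≡3v = invertible-solve 0<M 2⁻¹[M] (3 * w₀) (3 * v)
        w , x⇝w , 3w≡3w₀+2T = shifts T (⇝-forward x α ≤-refl)
    in  w , x⇝w , invertible-cancelˡ 3 3⁻¹[M] (≡[mod]-trans 3w≡3w₀+2T 3w₀+2T≡3v)

  ⇝-everywhere : ∀ x y → x ⇝ y
  ⇝-everywhere x y =
    let v , Uᵝv≡y = iterate-U-surjective β y
        w , x⇝w , w≡v = ⇝[mod]-every-class x v
        s , v+AMs≡w = ≡[mod]-lift w≡v 0<B (invertible-^ 2⁻¹[B] α)
        z = v + A * (M * s)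
        z≡v = ≡[mod]-+-∣ v (subst (A * M ∣_) (*-assoc A M s) (m∣m*n s))
    in  subst (x ⇝_) Uᵝv≡y (x⇝w z v+AMs≡w ◅◅ ⇝-backward v β ≤-refl z z≡v)

lemma3p6 : (N : ℕ) → .{{_ : NonZero N}} → 2 ≤ N → StronglyConnected N
lemma3p6 N _ a b =
  subst₂ (Star (Edge N)) (toℕ-mod a) (toℕ-mod b)
         (Connectivity.⇝-everywhere (splitting N) (toℕ a) (toℕ b))
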